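{- The logic $\mathbf{PM4}$ has unitary type of unification: every formula unifiable in $\mathbf{PM4}$ has a most general unifier.
   Context: $\mathbf{PM4}$ is the normal modal logic (extension of $\mathcal{S}4$) of all finite Kripke frames $\langle\{0,1,\dots,m\},R\rangle$, $m\ge1$, with $xRy\iff(x\le m-1\ \text{or}\ y=m)$. A unifier of $\varphi$ in $\mathcal{L}$ is a substitution $\sigma$ with $\sigma(\varphi)\in\mathcal{L}$. $\sigma$ is more general than $\sigma^1$ if there is a substitution $\sigma^2$ with $\sigma^1(p_i)\leftrightarrow\sigma^2(\sigma(p_i))\in\mathcal{L}$ for all variables $p_i$ of $\varphi$; a most general unifier is a unifier more general than every unifier. -}

module Defs where

open import Data.Nat using (ℕ; _<_; _≤_)
open import Data.Fin using (Fin; toℕ)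
open import Data.Bool using (Bool; true)
open import Data.Empty using (⊥)
open import Data.Product using (_×_; Σ)
open import Data.Sum using (_⊎_)
open import Relation.Binary.PropositionalEquality using (_≡_)

infixr 5 _⇒_
infixr 6 _∨_
infixr 7 _∧_
data Fm : Set where
  var  : ℕ → Fm
  ⊥'   : Fm
  _⇒_  : Fm → Fm → Fm
  _∧_  : Fm → Fm → Fm
  _∨_  : Fm → Fm → Fm
  □    : Fm → Fm

_⇔_ : Fm → Fm → Fm
a ⇔ b = (a ⇒ b) ∧ (b ⇒ a)

Subst : Set
Subst = ℕ → Fm

_[_] : Fm → Subst → Fm
var n   [ σ ] = σ n
⊥'      [ σ ] = ⊥'
(a ⇒ b) [ σ ] = (a [ σ ]) ⇒ (b [ σ ])
(a ∧ b) [ σ ] = (a [ σ ]) ∧ (b [ σ ])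
(a ∨ b) [ σ ] = (a [ σ ]) ∨ (b [ σ ])
□ a     [ σ ] = □ (a [ σ ])

data Occurs (n : ℕ) : Fm → Set where
  here : Occurs n (var n)
  ⇒l   : ∀ {a b} → Occurs n a → Occurs n (a ⇒ b)
  ⇒r   : ∀ {a b} → Occurs n b → Occurs n (a ⇒ b)
  ∧l   : ∀ {a b} → Occurs n a → Occurs n (a ∧ b)
  ∧r   : ∀ {a b} → Occurs n b → Occurs n (a ∧ b)
  ∨l   : ∀ {a b} → Occurs n a → Occurs n (a ∨ b)
  ∨r   : ∀ {a b} → Occurs n b → Occurs n (a ∨ b)
  □i   : ∀ {a} → Occurs n a → Occurs n (□ a)

R : (m : ℕ) → Fin (ℕ.suc m) → Fin (ℕ.suc m) → Set
R m x y = (toℕ x < m) ⊎ (toℕ y ≡ m)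

Val : ℕ → Set
Val m = ℕ → Fin (ℕ.suc m) → Bool

Sat : (m : ℕ) → Val m → Fin (ℕ.suc m) → Fm → Set
Sat m V x (var n) = V n x ≡ true
Sat m V x ⊥'      = ⊥
Sat m V x (a ⇒ b) = Sat m V x a → Sat m V x b
Sat m V x (a ∧ b) = Sat m V x a × Sat m V x b
Sat m V x (a ∨ b) = Sat m V x a ⊎ Sat m V x b
Sat m V x (□ a)   = ∀ y → R m x y → Sat m V y a

PM4 : Fm → Set
PM4 a = (m : ℕ) → 1 ≤ m → (V : Val m) → (x : Fin (ℕ.suc m)) → Sat m V x a

Unifier : Fm → Subst → Set
Unifier φ σ = PM4 (φ [ σ ])

MoreGeneral : Fm → Subst → Subst → Set
MoreGeneral φ σ σ₁ = Σ Subst λ σ₂ → ∀ n → Occurs n φ → PM4 (σ₁ n ⇔ (σ n [ σ₂ ]))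

MGU : Fm → Subst → Set
MGU φ σ = Unifier φ σ × (∀ σ₁ → Unifier φ σ₁ → MoreGeneral φ σ σ₁)

-- Fix a unifier τ of φ and put
--   σ(p) = (□φ ∧ p) ∨ (¬□φ ∧ ((◇□φ ∧ ◇□p) ∨ (¬◇□φ ∧ τ(p)))).
-- Wherever □φ holds, σ(p) is equivalent to p; so for any unifier σ₁ the
-- valuation induced by σ₁ makes φ globally true and σ(p)[σ₁] ↔ σ₁(p),
-- i.e. σ is more general than σ₁. To see that σ unifies φ, take a valuation
-- on F_m and look at the top point m, which every point sees and which sees
-- only itself, so that ◇□ψ holds anywhere iff ψ holds at m. If φ fails at m,
-- then □φ and ◇□φ fail everywhere and σ behaves as τ.
-- If φ holds everywhere, σ behaves as the identity. Otherwise φ holds at m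
-- but □φ fails at every point below m (such points see everything), so σ(p)
-- has, at every point, the value p has at m: the induced valuation is the
-- constant one collapsing F_m onto m, where φ is true.
module Submission where

open import Defs
open import Data.Bool using (true; false)
open import Data.Empty using (⊥-elim)
open import Data.Fin using (Fin; toℕ; fromℕ)
open import Data.Fin.Properties using (all?; toℕ-fromℕ; toℕ-injective; toℕ<n)
open import Data.Nat using (ℕ; suc; _<_; _≤_; _<?_; _≟_)
open import Data.Nat.Properties using (<-irrefl; m<1+n⇒m<n∨m≡n)
open import Data.Product using (Σ; _×_; _,_)
open import Data.Product.Function.NonDependent.Propositional using (_×-⇔_)
open import Data.Sum using (_⊎_; inj₁; inj₂)
open import Data.Sum.Function.Propositional using (_⊎-⇔_)
open import Function using (id; const)
open import Function.Bundles using (Equivalence; mk⇔) renaming (_⇔_ to _⟺_)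
open import Function.Construct.Composition using (_⇔-∘_)
open import Function.Construct.Identity using (⇔-id)
open import Function.Construct.Symmetry using (⇔-sym)
open import Function.Related.TypeIsomorphisms using (→-cong-⇔)
open import Relation.Nullary using (Dec; yes; no; does; ¬_; contradiction)
open import Relation.Nullary.Decidable using (_⊎-dec_; _→-dec_; _×-dec_)
open import Relation.Binary.PropositionalEquality using (_≡_; refl; sym; trans; subst)

open Equivalence using (to; from)

¬' : Fm → Fm
¬' a = a ⇒ ⊥'

◇ : Fm → Fm
◇ a = ¬' (□ (¬' a))

[var]-identity : ∀ a → a [ var ] ≡ a
[var]-identity (var n) = refl
[var]-identity ⊥'      = refl
[var]-identity (a ⇒ b) rewrite [var]-identity a | [var]-identity b = refl
[var]-identity (a ∧ b) rewrite [var]-identity a | [var]-identity b = refl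
[var]-identity (a ∨ b) rewrite [var]-identity a | [var]-identity b = refl
[var]-identity (□ a)   rewrite [var]-identity a = refl

does≡true⇔ : ∀ {A : Set} (a? : Dec A) → (does a? ≡ true) ⟺ A
does≡true⇔ (yes a) = mk⇔ (λ _ → a) (λ _ → refl)
does≡true⇔ (no ¬a) = mk⇔ (λ ()) (λ a → contradiction a ¬a)

module _ {m : ℕ} where

  top : Fin (suc m)
  top = fromℕ m

  R-top : (x : Fin (suc m)) → R m x top
  R-top x = inj₂ (toℕ-fromℕ m)

  R-from-top : ∀ {y} → R m top y → y ≡ top
  R-from-top (inj₁ m<m) = ⊥-elim (<-irrefl refl (subst (_< m) (toℕ-fromℕ m) m<m))
  R-from-top (inj₂ y≡m) = toℕ-injective (trans y≡m (sym (toℕ-fromℕ m)))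

  below-or-top : (y : Fin (suc m)) → toℕ y < m ⊎ y ≡ top
  below-or-top y with m<1+n⇒m<n∨m≡n (toℕ<n y)
  ... | inj₁ y<m = inj₁ y<m
  ... | inj₂ y≡m = inj₂ (toℕ-injective (trans y≡m (sym (toℕ-fromℕ m))))

  R? : ∀ x y → Dec (R m x y)
  R? x y = (toℕ x <? m) ⊎-dec (toℕ y ≟ m)

  sat? : ∀ (V : Val m) x a → Dec (Sat m V x a)
  sat? V x (var n) with V n x
  ... | true  = yes refl
  ... | false = no λ ()
  sat? V x ⊥'      = no id
  sat? V x (a ⇒ b) = sat? V x a →-dec sat? V x b
  sat? V x (a ∧ b) = sat? V x a ×-dec sat? V x b
  sat? V x (a ∨ b) = sat? V x a ⊎-dec sat? V x b
  sat? V x (□ a)   = all? λ y → R? x y →-dec sat? V y a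

  record PMorphism (f : Fin (suc m) → Fin (suc m)) : Set where
    field
      forth : ∀ {x y} → R m x y → R m (f x) (f y)
      back  : ∀ {x z} → R m (f x) z → Σ (Fin (suc m)) λ y → R m x y × f y ≡ z

  id-pmorphism : PMorphism id
  id-pmorphism = record { forth = id ; back = λ {_} {z} xRz → z , xRz , refl }

  const-top-pmorphism : PMorphism (const top)
  const-top-pmorphism = record
    { forth = λ _ → R-top top
    ; back  = λ {x} topRz → top , R-top x , sym (R-from-top topRz)
    }

  module _ {f : Fin (suc m) → Fin (suc m)} (f-pm : PMorphism f)
           (V V' : Val m) (σ : Subst)
           (V'≡σ : ∀ n y → (V' n y ≡ true) ⟺ Sat m V (f y) (σ n)) where
    open PMorphism f-pm

    sat-pmorphism-subst : ∀ a y → Sat m V' y a ⟺ Sat m V (f y) (a [ σ ])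
    sat-pmorphism-subst (var n) y = V'≡σ n y
    sat-pmorphism-subst ⊥'      y = ⇔-id _
    sat-pmorphism-subst (a ⇒ b) y = →-cong-⇔ (sat-pmorphism-subst a y) (sat-pmorphism-subst b y)
    sat-pmorphism-subst (a ∧ b) y = sat-pmorphism-subst a y ×-⇔ sat-pmorphism-subst b y
    sat-pmorphism-subst (a ∨ b) y = sat-pmorphism-subst a y ⊎-⇔ sat-pmorphism-subst b y
    sat-pmorphism-subst (□ a)   x = mk⇔
      (λ □a z fxRz → let (y , xRy , fy≡z) = back fxRz in
        subst (λ w → Sat m V w (a [ σ ])) fy≡z (to (sat-pmorphism-subst a y) (□a y xRy)))
      (λ □aσ y xRy → from (sat-pmorphism-subst a y) (□aσ (f y) (forth xRy)))

  sat-subst : ∀ (V V' : Val m) σ → (∀ n y → (V' n y ≡ true) ⟺ Sat m V y (σ n))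
            → ∀ a y → Sat m V' y a ⟺ Sat m V y (a [ σ ])
  sat-subst = sat-pmorphism-subst id-pmorphism

  _∙ᵛ_ : Val m → Subst → Val m
  (V ∙ᵛ σ) n y = does (sat? V y (σ n))

  sat-∙ᵛ : ∀ (V : Val m) σ a y → Sat m (V ∙ᵛ σ) y a ⟺ Sat m V y (a [ σ ])
  sat-∙ᵛ V σ = sat-subst V (V ∙ᵛ σ) σ λ n y → does≡true⇔ (sat? V y (σ n))

  sat-collapse : ∀ (V : Val m) a y → Sat m (λ n _ → V n top) y a ⟺ Sat m V top a
  sat-collapse V a y =
    subst (λ b → Sat m (λ n _ → V n top) y a ⟺ Sat m V top b) ([var]-identity a)
          (sat-pmorphism-subst const-top-pmorphism V (λ n _ → V n top) var (λ _ _ → ⇔-id _) a y)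

  ◇□⇔top : ∀ (V : Val m) a y → Sat m V y (◇ (□ a)) ⟺ Sat m V top a
  ◇□⇔top V a y = mk⇔ to-top from-top
    where
    from-top : Sat m V top a → Sat m V y (◇ (□ a))
    from-top a-top ¬□a =
      ¬□a top (R-top y) λ z topRz → subst (λ w → Sat m V w a) (sym (R-from-top topRz)) a-top
    to-top : Sat m V y (◇ (□ a)) → Sat m V top a
    to-top ◇□a with sat? V top a
    ... | yes a-top = a-top
    ... | no ¬a-top = ⊥-elim (◇□a λ z _ □a → ¬a-top (□a top (R-top z)))

module _ (φ : Fm) (τ : Subst) where

  mgu : Subst
  mgu n = (□ φ ∧ var n) ∨ (¬' (□ φ) ∧ ((◇ (□ φ) ∧ ◇ (□ (var n))) ∨ (¬' (◇ (□ φ)) ∧ τ n)))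

  module _ {m : ℕ} (V : Val m) where

    mgu-□ : ∀ n y → Sat m V y (□ φ) → (V n y ≡ true) ⟺ Sat m V y (mgu n)
    mgu-□ n y □φ = mk⇔ (λ p → inj₁ (□φ , p))
                       λ { (inj₁ (_ , p)) → p ; (inj₂ (¬□φ , _)) → contradiction □φ ¬□φ }

    mgu-¬□-top : ∀ n y → ¬ Sat m V y (□ φ) → Sat m V top φ → (V n top ≡ true) ⟺ Sat m V y (mgu n)
    mgu-¬□-top n y ¬□φ φ-top = mk⇔
      (λ p → inj₂ (¬□φ , inj₁ (◇□φ , from (◇□⇔top V (var n) y) p)))
      λ { (inj₁ (□φ , _))              → contradiction □φ ¬□φ
        ; (inj₂ (_ , inj₁ (_ , ◇□p)))  → to (◇□⇔top V (var n) y) ◇□p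
        ; (inj₂ (_ , inj₂ (¬◇□φ , _))) → contradiction ◇□φ ¬◇□φ }
      where ◇□φ = from (◇□⇔top V φ y) φ-top

    mgu-¬top : ∀ n y → ¬ Sat m V top φ → Sat m V y (τ n) ⟺ Sat m V y (mgu n)
    mgu-¬top n y ¬φ-top = mk⇔
      (λ τp → inj₂ (¬□φ , inj₂ (¬◇□φ , τp)))
      λ { (inj₁ (□φ , _))             → contradiction □φ ¬□φ
        ; (inj₂ (_ , inj₁ (◇□φ , _))) → contradiction ◇□φ ¬◇□φ
        ; (inj₂ (_ , inj₂ (_ , τp)))  → τp }
      where
      ¬□φ : ¬ Sat m V y (□ φ)
      ¬□φ □φ = ¬φ-top (□φ top (R-top y))
      ¬◇□φ : ¬ Sat m V y (◇ (□ φ))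
      ¬◇□φ ◇□φ = ¬φ-top (to (◇□⇔top V φ y) ◇□φ)

    mgu-global : (∀ z → Sat m V z φ) → ∀ n y → (V n y ≡ true) ⟺ Sat m V y (mgu n)
    mgu-global φ-global n y = mgu-□ n y λ z _ → φ-global z

    mgu-collapse : Sat m V top φ → ¬ (∀ z → Sat m V z φ)
                 → ∀ n y → (V n top ≡ true) ⟺ Sat m V y (mgu n)
    mgu-collapse φ-top ¬φ-global n y with sat? V y (□ φ)
    ... | no ¬□φ = mgu-¬□-top n y ¬□φ φ-top
    ... | yes □φ with below-or-top y
    ...   | inj₁ y<m = contradiction (λ z → □φ z (inj₁ y<m)) ¬φ-global
    ...   | inj₂ refl = mgu-□ n top □φ

  mgu-unifies : Unifier φ τ → Unifier φ mgu
  mgu-unifies τ-unifies m 1≤m V x with sat? V top φ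
  ... | no ¬φ-top =
    to (sat-subst V (V ∙ᵛ τ) mgu τ⇔mgu φ x) (from (sat-∙ᵛ V τ φ x) (τ-unifies m 1≤m V x))
    where
    τ⇔mgu : ∀ n y → ((V ∙ᵛ τ) n y ≡ true) ⟺ Sat m V y (mgu n)
    τ⇔mgu n y = mgu-¬top V n y ¬φ-top ⇔-∘ does≡true⇔ (sat? V y (τ n))
  ... | yes φ-top with all? (λ z → sat? V z φ)
  ...   | yes φ-global = to (sat-subst V V mgu (mgu-global V φ-global) φ x) (φ-global x)
  ...   | no ¬φ-global =
    to (sat-subst V (λ n _ → V n top) mgu (mgu-collapse V φ-top ¬φ-global) φ x)
       (from (sat-collapse V φ x) φ-top)

  mgu-most-general : ∀ σ₁ → Unifier φ σ₁ → MoreGeneral φ mgu σ₁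
  mgu-most-general σ₁ σ₁-unifies = σ₁ , λ n _ m 1≤m V x →
    let σ₁⇔mgu = sat-∙ᵛ V σ₁ (mgu n) x
                   ⇔-∘ (mgu-global (V ∙ᵛ σ₁) (φ-global m 1≤m V) n x
                   ⇔-∘ ⇔-sym (does≡true⇔ (sat? V x (σ₁ n))))
    in to σ₁⇔mgu , from σ₁⇔mgu
    where
    φ-global : ∀ m → 1 ≤ m → (V : Val m) → ∀ z → Sat m (V ∙ᵛ σ₁) z φ
    φ-global m 1≤m V z = from (sat-∙ᵛ V σ₁ φ z) (σ₁-unifies m 1≤m V z)

corollary5 : (φ : Fm) → Σ Subst (Unifier φ) → Σ Subst (MGU φ)
corollary5 φ (τ , τ-unifies) = mgu φ τ , mgu-unifies φ τ τ-unifies , mgu-most-general φ τ
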